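{- A game $G$ is tame if and only if it is $t$-miserable.
   Context: A game is a two-player impartial game given by a directed acyclic graph whose vertices are positions and whose arcs are moves, such that from every position only finitely many positions are reachable. A position with no moves is terminal. $\operatorname{mex}(S)$ is the least non-negative integer not in $S$. The normal Sprague–Grundy function is $\mathcal{G}(x)=\operatorname{mex}\{\mathcal{G}(y): x\to y\}$ (so $0$ on terminal positions); the misère Sprague–Grundy function $\mathcal{G}^-$ satisfies $\mathcal{G}^-(x)=1$ for terminal $x$ and $\mathcal{G}^-(x)=\operatorname{mex}\{\mathcal{G}^-(y): x\to y\}$ otherwise. An $(i,j)$-position is a position $x$ with $\mathcal{G}(x)=i$, $\mathcal{G}^-(x)=j$; $V_{i,j}$ denotes the set of $(i,j)$-positions. A position $x$ is movable to a set $W$ if there is a move from $x$ to some position of $W$. A game is tame if every position is a $(0,1)$-position, a $(1,0)$-position, or a $(k,k)$-position for some $k\ge 0$. A game is $t$-miserable if every position $x$ satisfies at least one of: (a$_0$) $x\in V_{0,1}\cup V_{1,0}\cup V_{0,0}\cup V_{1,1}$; (c) $x$ is movable to $V_{0,1}$ and to $V_{1,0}$; (e) $x$ is movable to $V_{0,0}$ and to $V_{1,1}$. -}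

module Defs where

open import Data.Nat using (ℕ; zero; suc; _≡ᵇ_)
open import Data.Bool using (Bool; true; false; if_then_else_; _∨_)
open import Data.Fin using (Fin; zero; suc)
open import Data.Product using (Σ; ∃; ∃-syntax; _×_; _,_)
open import Data.Sum using (_⊎_)
open import Relation.Binary.PropositionalEquality using (_≡_; refl)
open import Induction.WellFounded using (WellFounded; Acc; acc)

-- Finite branching + well-foundedness = acyclic and only finitely many
-- positions reachable from any position.
record Game : Set₁ where
  field
    Pos    : Set
    nmoves : Pos → ℕ
    move   : (x : Pos) → Fin (nmoves x) → Pos

  _⊏_ : Pos → Pos → Set
  y ⊏ x = ∃[ i ] (move x i ≡ y)

  field
    wf : WellFounded _⊏_

occurs : (n : ℕ) → (Fin n → ℕ) → ℕ → Bool
occurs zero    f k = false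
occurs (suc n) f k = (f zero ≡ᵇ k) ∨ occurs n (λ i → f (suc i)) k

mexSearch : (n : ℕ) → (Fin n → ℕ) → ℕ → ℕ → ℕ
mexSearch n f zero       k = k
mexSearch n f (suc fuel) k = if occurs n f k then mexSearch n f fuel (suc k) else k

-- mex of the finite set {f i : i < n}: least natural number not in it
-- (it is at most n, so fuel n+1 suffices)
mex : (n : ℕ) → (Fin n → ℕ) → ℕ
mex n f = mexSearch n f (suc n) 0

module _ (g : Game) where
  open Game g

  SGacc : (x : Pos) → Acc _⊏_ x → ℕ
  SGacc x (acc rs) = mex (nmoves x) (λ i → SGacc (move x i) (rs (i , refl)))

  SG : Pos → ℕ
  SG x = SGacc x (wf x)

  SG⁻acc : (x : Pos) → Acc _⊏_ x → ℕ
  SG⁻acc x (acc rs) =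
    if nmoves x ≡ᵇ 0 then 1
    else mex (nmoves x) (λ i → SG⁻acc (move x i) (rs (i , refl)))

  SG⁻ : Pos → ℕ
  SG⁻ x = SG⁻acc x (wf x)

  InV : ℕ → ℕ → Pos → Set
  InV i j x = SG x ≡ i × SG⁻ x ≡ j

  MovableTo : ℕ → ℕ → Pos → Set
  MovableTo i j x = ∃[ m ] InV i j (move x m)

  Tame : Set
  Tame = ∀ x → InV 0 1 x ⊎ InV 1 0 x ⊎ (∃[ k ] InV k k x)

  TMiserable : Set
  TMiserable = ∀ x →
      (InV 0 1 x ⊎ InV 1 0 x ⊎ InV 0 0 x ⊎ InV 1 1 x)
    ⊎ (MovableTo 0 1 x × MovableTo 1 0 x)                     -- (c)
    ⊎ (MovableTo 0 0 x × MovableTo 1 1 x)                     -- (e)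

-- In a tame game an option's normal and misère values agree unless they
-- are the pair (0,1) or (1,0). Hence, if the options of x are tame and the
-- values 0 and 1 occur among them both normally and in misère play, the
-- two mex computations at x see the same sets, so G(x) = G⁻(x); conditions
-- (c) and (e) supply exactly these four values, which gives t-miserable ⇒
-- tame by well-founded induction. Conversely, at a tame (k,k)-position with
-- k ≥ 2 there are options with G = 0, G = 1, G⁻ = 0 and G⁻ = 1; each of them
-- lies in one of two of the sets V₀₁, V₁₀, V₀₀, V₁₁, and every choice among
-- these alternatives yields (c) or (e).
module Submission where

open import Defs
open import Function.Bundles using (_⇔_; mk⇔; Equivalence)
open import Data.Nat using (ℕ; zero; suc; _+_; _≡ᵇ_; _<_; _≤_; z≤n; s≤s)
open import Data.Nat.Properties using (≡ᵇ⇒≡; ≡⇒≡ᵇ; m≤n⇒m<n∨m≡n; <⇒≱; 0≢1+n; 1+n≢0; suc-injective)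
open import Data.Bool using (true; false; if_then_else_; T)
open import Data.Bool.Properties using (T-∨)
open import Data.Fin using (Fin; zero; suc)
open import Data.Product using (∃; ∃-syntax; _×_; _,_)
open import Data.Sum using (_⊎_; inj₁; inj₂)
import Data.Sum as Sum
open import Data.Empty using (⊥-elim)
open import Relation.Nullary.Reflects using (Reflects; fromEquivalence; det)
open import Relation.Binary.PropositionalEquality using (_≡_; _≢_; refl; sym; trans; cong; subst; module ≡-Reasoning)
open import Induction.WellFounded using (Acc; acc)

Occurs : (n : ℕ) → (Fin n → ℕ) → ℕ → Set
Occurs n f k = ∃ λ i → f i ≡ k

occurs-sound : ∀ n (f : Fin n → ℕ) k → T (occurs n f k) → Occurs n f k
occurs-sound (suc n) f k t
  with Equivalence.to (T-∨ {f zero ≡ᵇ k} {occurs n (λ i → f (suc i)) k}) t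
... | inj₁ hit = zero , ≡ᵇ⇒≡ (f zero) k hit
... | inj₂ later with occurs-sound n (λ i → f (suc i)) k later
...   | i , fi≡k = suc i , fi≡k

occurs-complete : ∀ n (f : Fin n → ℕ) k → Occurs n f k → T (occurs n f k)
occurs-complete (suc n) f k (i , fi≡k) =
  Equivalence.from (T-∨ {f zero ≡ᵇ k} {occurs n (λ i → f (suc i)) k}) (found i fi≡k)
  where
  found : ∀ i → f i ≡ k → T (f zero ≡ᵇ k) ⊎ T (occurs n (λ i → f (suc i)) k)
  found zero    p = inj₁ (≡⇒≡ᵇ (f zero) k p)
  found (suc i) p = inj₂ (occurs-complete n (λ i → f (suc i)) k (i , p))

occurs-reflects : ∀ n (f : Fin n → ℕ) k → Reflects (Occurs n f k) (occurs n f k)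
occurs-reflects n f k = fromEquivalence (occurs-sound n f k) (occurs-complete n f k)

mex-cong : ∀ n (f h : Fin n → ℕ) → (∀ k → Occurs n f k ⇔ Occurs n h k) → mex n f ≡ mex n h
mex-cong n f h same = mexSearch-cong (suc n) 0
  where
  occurs-cong : ∀ k → occurs n f k ≡ occurs n h k
  occurs-cong k = det (occurs-reflects n f k)
    (fromEquivalence (λ t → Equivalence.from (same k) (occurs-sound n h k t))
                     (λ o → occurs-complete n h k (Equivalence.to (same k) o)))

  mexSearch-cong : ∀ fuel k → mexSearch n f fuel k ≡ mexSearch n h fuel k
  mexSearch-cong zero       k = refl
  mexSearch-cong (suc fuel) k rewrite occurs-cong k | mexSearch-cong fuel (suc k) = refl

mex-cong-pointwise : ∀ n (f h : Fin n → ℕ) → (∀ i → f i ≡ h i) → mex n f ≡ mex n h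
mex-cong-pointwise n f h f≗h = mex-cong n f h λ k →
  mk⇔ (λ (i , p) → i , trans (sym (f≗h i)) p) (λ (i , p) → i , trans (f≗h i) p)

mex-below-occurs : ∀ n (f : Fin n → ℕ) {j} → j < mex n f → Occurs n f j
mex-below-occurs n f = search (suc n) z≤n
  where
  search : ∀ fuel {k j} → k ≤ j → j < mexSearch n f fuel k → Occurs n f j
  search zero       k≤j j<k = ⊥-elim (<⇒≱ j<k k≤j)
  search (suc fuel) {k} k≤j j<mex with occurs n f k in eq
  ... | false = ⊥-elim (<⇒≱ j<mex k≤j)
  ... | true with m≤n⇒m<n∨m≡n k≤j
  ...   | inj₁ k<j  = search fuel k<j j<mex
  ...   | inj₂ refl = occurs-sound n f k (subst T (sym eq) _)

if-≡ᵇ0-nonzero : ∀ n {A : Set} (a b : A) → Fin n → (if n ≡ᵇ 0 then a else b) ≡ b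
if-≡ᵇ0-nonzero (suc n) a b _ = refl

if-≡ᵇ0-≢ : ∀ n {A : Set} (a b : A) → (if n ≡ᵇ 0 then a else b) ≢ a → (if n ≡ᵇ 0 then a else b) ≡ b
if-≡ᵇ0-≢ zero    a b ≢a = ⊥-elim (≢a refl)
if-≡ᵇ0-≢ (suc n) a b ≢a = refl

⊎-pair-up : ∀ {A B C D : Set} → A ⊎ B → C ⊎ D → C ⊎ B → A ⊎ D → (A × C) ⊎ (B × D)
⊎-pair-up (inj₁ a) (inj₁ c) _        _        = inj₁ (a , c)
⊎-pair-up (inj₂ b) (inj₂ d) _        _        = inj₂ (b , d)
⊎-pair-up (inj₁ a) (inj₂ d) (inj₁ c) _        = inj₁ (a , c)
⊎-pair-up (inj₁ a) (inj₂ d) (inj₂ b) _        = inj₂ (b , d)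
⊎-pair-up (inj₂ b) (inj₁ c) _        (inj₁ a) = inj₁ (a , c)
⊎-pair-up (inj₂ b) (inj₁ c) _        (inj₂ d) = inj₂ (b , d)

module _ (g : Game) where
  open Game g

  SGacc-irrelevant : ∀ x (a b : Acc _⊏_ x) → SGacc g x a ≡ SGacc g x b
  SGacc-irrelevant x (acc rs) (acc rs′) = mex-cong-pointwise (nmoves x) _ _ λ i →
    SGacc-irrelevant (move x i) (rs (i , refl)) (rs′ (i , refl))

  SG⁻acc-irrelevant : ∀ x (a b : Acc _⊏_ x) → SG⁻acc g x a ≡ SG⁻acc g x b
  SG⁻acc-irrelevant x (acc rs) (acc rs′) = cong (λ v → if nmoves x ≡ᵇ 0 then 1 else v)
    (mex-cong-pointwise (nmoves x) _ _ λ i →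
      SG⁻acc-irrelevant (move x i) (rs (i , refl)) (rs′ (i , refl)))

  SG-options SG⁻-options : (x : Pos) → Fin (nmoves x) → ℕ
  SG-options  x i = SG g (move x i)
  SG⁻-options x i = SG⁻ g (move x i)

  SG-unfold : ∀ x → SG g x ≡ mex (nmoves x) (SG-options x)
  SG-unfold x with wf x
  ... | acc rs = mex-cong-pointwise (nmoves x) _ _ λ i →
    SGacc-irrelevant (move x i) (rs (i , refl)) (wf (move x i))

  SG⁻-unfold : ∀ x → SG⁻ g x ≡ (if nmoves x ≡ᵇ 0 then 1 else mex (nmoves x) (SG⁻-options x))
  SG⁻-unfold x with wf x
  ... | acc rs = cong (λ v → if nmoves x ≡ᵇ 0 then 1 else v)
    (mex-cong-pointwise (nmoves x) _ _ λ i →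
      SG⁻acc-irrelevant (move x i) (rs (i , refl)) (wf (move x i)))

  SG⁻-unfold-nonterminal : ∀ x → Fin (nmoves x) → SG⁻ g x ≡ mex (nmoves x) (SG⁻-options x)
  SG⁻-unfold-nonterminal x i =
    trans (SG⁻-unfold x) (if-≡ᵇ0-nonzero (nmoves x) 1 (mex (nmoves x) (SG⁻-options x)) i)

  SG⁻-unfold-≢1 : ∀ x → SG⁻ g x ≢ 1 → SG⁻ g x ≡ mex (nmoves x) (SG⁻-options x)
  SG⁻-unfold-≢1 x ≢1 = trans (SG⁻-unfold x)
    (if-≡ᵇ0-≢ (nmoves x) 1 _ λ eq → ≢1 (trans (SG⁻-unfold x) eq))

  SG-options-below : ∀ x {j} → j < SG g x → Occurs (nmoves x) (SG-options x) j
  SG-options-below x j<SG = mex-below-occurs (nmoves x) (SG-options x) (subst (_ <_) (SG-unfold x) j<SG)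

  SG⁻-options-below : ∀ x {j} → SG⁻ g x ≢ 1 → j < SG⁻ g x → Occurs (nmoves x) (SG⁻-options x) j
  SG⁻-options-below x ≢1 j<SG⁻ =
    mex-below-occurs (nmoves x) (SG⁻-options x) (subst (_ <_) (SG⁻-unfold-≢1 x ≢1) j<SG⁻)

  TameAt : Pos → Set
  TameAt x = InV g 0 1 x ⊎ InV g 1 0 x ⊎ (∃[ k ] InV g k k x)

  SG≡SG⁻⇒tame : ∀ {x} → SG g x ≡ SG⁻ g x → TameAt x
  SG≡SG⁻⇒tame {x} eq = inj₂ (inj₂ (SG g x , refl , sym eq))

  tame-SG≡0 : ∀ {y} → TameAt y → SG g y ≡ 0 → InV g 0 1 y ⊎ InV g 0 0 y
  tame-SG≡0 (inj₁ v)                     _ = inj₁ v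
  tame-SG≡0 (inj₂ (inj₁ (eq , _)))       e = ⊥-elim (1+n≢0 (trans (sym eq) e))
  tame-SG≡0 (inj₂ (inj₂ (_ , eq , eq⁻))) e = inj₂ (e , trans eq⁻ (trans (sym eq) e))

  tame-SG≡1 : ∀ {y} → TameAt y → SG g y ≡ 1 → InV g 1 0 y ⊎ InV g 1 1 y
  tame-SG≡1 (inj₁ (eq , _))              e = ⊥-elim (0≢1+n (trans (sym eq) e))
  tame-SG≡1 (inj₂ (inj₁ v))              _ = inj₁ v
  tame-SG≡1 (inj₂ (inj₂ (_ , eq , eq⁻))) e = inj₂ (e , trans eq⁻ (trans (sym eq) e))

  tame-SG⁻≡0 : ∀ {y} → TameAt y → SG⁻ g y ≡ 0 → InV g 1 0 y ⊎ InV g 0 0 y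
  tame-SG⁻≡0 (inj₁ (_ , eq⁻))             e = ⊥-elim (1+n≢0 (trans (sym eq⁻) e))
  tame-SG⁻≡0 (inj₂ (inj₁ v))              _ = inj₁ v
  tame-SG⁻≡0 (inj₂ (inj₂ (_ , eq , eq⁻))) e = inj₂ (trans eq (trans (sym eq⁻) e) , e)

  tame-SG⁻≡1 : ∀ {y} → TameAt y → SG⁻ g y ≡ 1 → InV g 0 1 y ⊎ InV g 1 1 y
  tame-SG⁻≡1 (inj₁ v)                     _ = inj₁ v
  tame-SG⁻≡1 (inj₂ (inj₁ (_ , eq⁻)))      e = ⊥-elim (0≢1+n (trans (sym eq⁻) e))
  tame-SG⁻≡1 (inj₂ (inj₂ (_ , eq , eq⁻))) e = inj₂ (trans eq (trans (sym eq⁻) e) , e)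

  tame-SG≡SG⁻-above-1 : ∀ {y} → TameAt y → ∀ m → SG g y ≡ 2 + m ⇔ SG⁻ g y ≡ 2 + m
  tame-SG≡SG⁻-above-1 (inj₁ (eq , eq⁻)) m =
    mk⇔ (λ p → ⊥-elim (0≢1+n (trans (sym eq) p)))
        (λ p → ⊥-elim (0≢1+n (suc-injective (trans (sym eq⁻) p))))
  tame-SG≡SG⁻-above-1 (inj₂ (inj₁ (eq , eq⁻))) m =
    mk⇔ (λ p → ⊥-elim (0≢1+n (suc-injective (trans (sym eq) p))))
        (λ p → ⊥-elim (0≢1+n (trans (sym eq⁻) p)))
  tame-SG≡SG⁻-above-1 (inj₂ (inj₂ (_ , eq , eq⁻))) m =
    mk⇔ (λ p → trans eq⁻ (trans (sym eq) p)) (λ p → trans eq (trans (sym eq⁻) p))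

  HasLowOptions : Pos → Set
  HasLowOptions x = Occurs (nmoves x) (SG-options x) 0 × Occurs (nmoves x) (SG-options x) 1
                  × Occurs (nmoves x) (SG⁻-options x) 0 × Occurs (nmoves x) (SG⁻-options x) 1

  high-diagonal⇒low-options : ∀ {x} m → InV g (2 + m) (2 + m) x → HasLowOptions x
  high-diagonal⇒low-options {x} m (eq , eq⁻) =
      SG-options-below x (subst (0 <_) (sym eq) (s≤s z≤n))
    , SG-options-below x (subst (1 <_) (sym eq) (s≤s (s≤s z≤n)))
    , SG⁻-options-below x ≢1 (subst (0 <_) (sym eq⁻) (s≤s z≤n))
    , SG⁻-options-below x ≢1 (subst (1 <_) (sym eq⁻) (s≤s (s≤s z≤n)))
    where
    ≢1 : SG⁻ g x ≢ 1
    ≢1 p = 1+n≢0 (suc-injective (trans (sym eq⁻) p))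

  low-options⇒SG≡SG⁻ : ∀ x → (∀ i → TameAt (move x i)) → HasLowOptions x → SG g x ≡ SG⁻ g x
  low-options⇒SG≡SG⁻ x tame (f0 , f1 , h0@(i , _) , h1) = begin
    SG g x                             ≡⟨ SG-unfold x ⟩
    mex (nmoves x) (SG-options x)      ≡⟨ mex-cong (nmoves x) _ _ sameValues ⟩
    mex (nmoves x) (SG⁻-options x)     ≡⟨ sym (SG⁻-unfold-nonterminal x i) ⟩
    SG⁻ g x                            ∎
    where
    open ≡-Reasoning
    sameValues : ∀ k → Occurs (nmoves x) (SG-options x) k ⇔ Occurs (nmoves x) (SG⁻-options x) k
    sameValues zero          = mk⇔ (λ _ → h0) (λ _ → f0)
    sameValues (suc zero)    = mk⇔ (λ _ → h1) (λ _ → f1)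
    sameValues (suc (suc m)) =
      mk⇔ (λ (j , p) → j , Equivalence.to   (tame-SG≡SG⁻-above-1 (tame j) m) p)
          (λ (j , p) → j , Equivalence.from (tame-SG≡SG⁻-above-1 (tame j) m) p)

  low-options⇒c⊎e : ∀ x → (∀ i → TameAt (move x i)) → HasLowOptions x →
    (MovableTo g 0 1 x × MovableTo g 1 0 x) ⊎ (MovableTo g 0 0 x × MovableTo g 1 1 x)
  low-options⇒c⊎e x tame ((i₀ , f0) , (i₁ , f1) , (j₀ , h0) , (j₁ , h1)) = ⊎-pair-up
    (via i₀ (tame-SG≡0 (tame i₀) f0)) (via i₁ (tame-SG≡1 (tame i₁) f1))
    (via j₀ (tame-SG⁻≡0 (tame j₀) h0)) (via j₁ (tame-SG⁻≡1 (tame j₁) h1))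
    where
    via : ∀ {a b c d} i → InV g a b (move x i) ⊎ InV g c d (move x i) →
          MovableTo g a b x ⊎ MovableTo g c d x
    via i = Sum.map (i ,_) (i ,_)

  c⊎e⇒low-options : ∀ {x} →
    (MovableTo g 0 1 x × MovableTo g 1 0 x) ⊎ (MovableTo g 0 0 x × MovableTo g 1 1 x) →
    HasLowOptions x
  c⊎e⇒low-options (inj₁ ((a , a0 , a1) , (b , b1 , b0))) = (a , a0) , (b , b1) , (b , b0) , (a , a1)
  c⊎e⇒low-options (inj₂ ((a , a0 , a0⁻) , (b , b1 , b1⁻))) = (a , a0) , (b , b1) , (a , a0⁻) , (b , b1⁻)

  tame⇒tmiserable : Tame g → TMiserable g
  tame⇒tmiserable tame x with tame x
  ... | inj₁ v                        = inj₁ (inj₁ v)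
  ... | inj₂ (inj₁ v)                 = inj₁ (inj₂ (inj₁ v))
  ... | inj₂ (inj₂ (0 , v))           = inj₁ (inj₂ (inj₂ (inj₁ v)))
  ... | inj₂ (inj₂ (1 , v))           = inj₁ (inj₂ (inj₂ (inj₂ v)))
  ... | inj₂ (inj₂ (suc (suc m) , v)) =
    inj₂ (low-options⇒c⊎e x (λ i → tame (move x i)) (high-diagonal⇒low-options m v))

  tmiserable⇒tame : TMiserable g → Tame g
  tmiserable⇒tame tm x = go x (wf x)
    where
    go : ∀ x → Acc _⊏_ x → TameAt x
    go x (acc rs) with tm x
    ... | inj₁ (inj₁ v)                 = inj₁ v
    ... | inj₁ (inj₂ (inj₁ v))          = inj₂ (inj₁ v)
    ... | inj₁ (inj₂ (inj₂ (inj₁ v)))   = inj₂ (inj₂ (0 , v))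
    ... | inj₁ (inj₂ (inj₂ (inj₂ v)))   = inj₂ (inj₂ (1 , v))
    ... | inj₂ c⊎e = SG≡SG⁻⇒tame (low-options⇒SG≡SG⁻ x (λ i → go (move x i) (rs (i , refl)))
                                                       (c⊎e⇒low-options c⊎e))

theorem3p3 : (g : Game) → Tame g ⇔ TMiserable g
theorem3p3 g = mk⇔ (tame⇒tmiserable g) (tmiserable⇒tame g)
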